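{- Let $T$ be a finite tree, $v$ a leaf of $T$ with neighbor $w$, and let $n_l$ (resp. $n_i$) be the number of neighbors of $w$ that are leaves (resp. inner nodes). Let $\mathcal{M}\in\{\mathcal{MIN},\mathcal{MAJ}\}$. If $n_l>n_i$ then there is a one-to-one correspondence between $\mathcal{F}_{\mathcal{M}}(T)$ and $\mathcal{F}_{\mathcal{M}}(T\setminus v)$.
   Context: Colorings are maps $c:V\to\{0,1\}$; $N^i(v)$ is the set of neighbors of $v$ with color $i$. $\mathcal{MIN}(c)(v)=c(v)$ if $|N^{c(v)}(v)|\le|N^{1-c(v)}(v)|$, else $1-c(v)$; $\mathcal{MAJ}(c)(v)=c(v)$ if $|N^{c(v)}(v)|\ge|N^{1-c(v)}(v)|$, else $1-c(v)$. $\mathcal{F}_{\mathcal{M}}(T)$ is the set of colorings $c$ with $\mathcal{M}(c)=c$. Inner nodes are nodes of degree at least $2$. -}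

module Defs where

open import Data.Nat using (ℕ; suc; _≤_; _<_)
open import Data.Bool using (Bool; true; false; not; _∧_; _xor_; if_then_else_; T)
open import Data.Fin using (Fin; punchIn)
open import Data.List using (List; []; _∷_; length; filterᵇ; head; last)
open import Data.Vec using (Vec; lookup; tabulate)
open import Data.Maybe using (Maybe; just; nothing)
open import Data.List.Relation.Unary.Unique.Propositional using (Unique)
open import Data.List.Relation.Unary.Linked using (Linked)
open import Relation.Binary.PropositionalEquality using (_≡_)
open import Relation.Nullary using (¬_)
open import Data.Product using (_×_; Σ)

open import Data.List using (allFin) public

Graph : ℕ → Set
Graph n = Fin n → Fin n → Bool

Adj : ∀ {n} → Graph n → Fin n → Fin n → Set
Adj G u w = T (G u w)

IsSimple : ∀ {n} → Graph n → Set
IsSimple {n} G = (∀ u w → G u w ≡ G w u) × (∀ u → G u u ≡ false)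

data Walk {n} (G : Graph n) : Fin n → Fin n → Set where
  here : ∀ {u} → Walk G u u
  step : ∀ {u x w} → Adj G u x → Walk G x w → Walk G u w

IsConnected : ∀ {n} → Graph n → Set
IsConnected {n} G = ∀ (u w : Fin n) → Walk G u w

record Cycle {n} (G : Graph n) : Set where
  field
    verts    : List (Fin n)
    long     : 3 ≤ length verts
    distinct : Unique verts
    linked   : Linked (Adj G) verts
    first    : Fin n
    final    : Fin n
    isFirst  : head verts ≡ just first
    isFinal  : last verts ≡ just final
    closes   : Adj G final first

IsAcyclic : ∀ {n} → Graph n → Set
IsAcyclic G = ¬ Cycle G

-- finite tree: nonempty (vertex set Fin (suc n)), simple, connected, acyclic
IsTree : ∀ {n} → Graph (suc n) → Set
IsTree G = IsSimple G × IsConnected G × IsAcyclic G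

degree : ∀ {n} → Graph n → Fin n → ℕ
degree {n} G v = length (filterᵇ (G v) (allFin n))

IsLeaf : ∀ {n} → Graph n → Fin n → Set
IsLeaf G v = degree G v ≡ 1

isLeafᵇ : ∀ {n} → Graph n → Fin n → Bool
isLeafᵇ G u with degree G u
... | 1 = true
... | _ = false

isInnerᵇ : ∀ {n} → Graph n → Fin n → Bool
isInnerᵇ G u with degree G u
... | 0 = false
... | 1 = false
... | _ = true

nLeaf : ∀ {n} → Graph n → Fin n → ℕ
nLeaf {n} G w = length (filterᵇ (λ u → G w u ∧ isLeafᵇ G u) (allFin n))

nInner : ∀ {n} → Graph n → Fin n → ℕ
nInner {n} G w = length (filterᵇ (λ u → G w u ∧ isInnerᵇ G u) (allFin n))

Coloring : ℕ → Set
Coloring n = Vec Bool n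

eqᵇ : Bool → Bool → Bool
eqᵇ x y = not (x xor y)

nbrCount : ∀ {n} → Graph n → Coloring n → Fin n → Bool → ℕ
nbrCount {n} G c v i = length (filterᵇ (λ u → G v u ∧ eqᵇ (lookup c u) i) (allFin n))

data Mode : Set where
  MIN MAJ : Mode

_≤ᵇ'_ : ℕ → ℕ → Bool
0 ≤ᵇ' _ = true
suc _ ≤ᵇ' 0 = false
suc m ≤ᵇ' suc k = m ≤ᵇ' k

update : ∀ {n} → Mode → Graph n → Coloring n → Fin n → Bool
update MIN G c v =
  if nbrCount G c v (lookup c v) ≤ᵇ' nbrCount G c v (not (lookup c v))
  then lookup c v else not (lookup c v)
update MAJ G c v =
  if nbrCount G c v (not (lookup c v)) ≤ᵇ' nbrCount G c v (lookup c v)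
  then lookup c v else not (lookup c v)

apply : ∀ {n} → Mode → Graph n → Coloring n → Coloring n
apply M G c = tabulate (update M G c)

Fixed : ∀ {n} → Mode → Graph n → Set
Fixed {n} M G = Σ (Coloring n) (λ c → apply M G c ≡ c)

-- T \ v : delete vertex v, the remaining vertices being re-indexed by punchIn v
removeVertex : ∀ {n} → Graph (suc n) → Fin (suc n) → Graph n
removeVertex G v i j = G (punchIn v i) (punchIn v j)

{-# OPTIONS --safe #-}
module Submission where

-- In a fixed point the colour of a leaf is forced by its neighbour (equal to it under MAJ,
-- opposite under MIN), so deleting the leaf v loses no information and re-inserting it with the
-- forced colour is the inverse. No vertex other than w sees v, so stability is only in question
-- at w. There every leaf neighbour carries the colour preferred by w, so that colour gets at least
-- n_l votes while the other gets at most n_i < n_l: the margin is strict and survives losing v's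
-- vote; adding v's vote back can only help. Apart from simplicity of the graph, nothing about
-- trees is used.

open import Defs
open import Data.Nat using (ℕ; zero; suc; _+_; _≤_; _<_; z≤n; s≤s; s≤s⁻¹)
open import Data.Nat.Properties
  using (≤-refl; ≤-reflexive; ≤-trans; ≤-<-trans; <-≤-trans; +-mono-≤; +-identityʳ;
         +-commutativeSemigroup; suc-injective; n≤0⇒n≡0; n>0⇒n≢0; m≤n⇒m≤1+n)
open import Algebra.Properties.CommutativeSemigroup +-commutativeSemigroup using (x∙yz≈y∙xz)
open import Data.Bool using (Bool; true; false; not; _∧_; if_then_else_; T)
open import Data.Bool.Properties using (T-≡; T-∧; not-involutive; not-¬) renaming (_≟_ to _≟ᵇ_)
open import Data.Fin using (Fin; zero; suc; punchIn; punchOut; _≟_)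
open import Data.Fin.Properties using (punchIn-injective; punchInᵢ≢i; punchIn-punchOut; punchOut-punchIn)
open import Data.List using (length; filterᵇ)
import Data.List as List
open import Data.Vec using (Vec; lookup; removeAt; insertAt)
open import Data.Vec.Properties
  using (lookup∘tabulate; tabulate∘lookup; tabulate-cong; insertAt-lookup; insertAt-punchIn;
         removeAt-insertAt; insertAt-removeAt; removeAt-punchOut; ≡-dec)
open import Data.Product using (_,_; proj₁; proj₂)
open import Function using (_∘_; id)
open import Function.Bundles using (_⇔_; _⤖_; mk⇔; mk↔ₛ′; Equivalence)
open import Function.Construct.Composition using (_⇔-∘_)
open import Function.Properties.Inverse using (↔⇒⤖)
open import Relation.Binary.PropositionalEquality
  using (_≡_; _≢_; refl; sym; trans; cong; cong₂; subst; subst₂; module ≡-Reasoning)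
open import Relation.Nullary using (¬_; yes; no; contradiction)
open import Axiom.UniquenessOfIdentityProofs using (module Decidable⇒UIP)

open Equivalence using (to; from)

indicator : Bool → ℕ
indicator true  = 1
indicator false = 0

indicator-mono : ∀ {a b} → (T a → T b) → indicator a ≤ indicator b
indicator-mono {false}         _ = z≤n
indicator-mono {true}  {true}  _ = ≤-refl
indicator-mono {true}  {false} h = contradiction _ h

count : ∀ {n} → (Fin n → Bool) → ℕ
count {zero}  f = 0
count {suc n} f = indicator (f zero) + count (f ∘ suc)

length-filterᵇ-tabulate : ∀ {n} {A : Set} (g : Fin n → A) (p : A → Bool) →
  length (filterᵇ p (List.tabulate g)) ≡ count (p ∘ g)
length-filterᵇ-tabulate {zero}  g p = refl
length-filterᵇ-tabulate {suc n} g p with p (g zero)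
... | true  = cong suc (length-filterᵇ-tabulate (g ∘ suc) p)
... | false = length-filterᵇ-tabulate (g ∘ suc) p

count-cong : ∀ {n} {f g : Fin n → Bool} → (∀ i → f i ≡ g i) → count f ≡ count g
count-cong {zero}  f≡g = refl
count-cong {suc n} f≡g = cong₂ _+_ (cong indicator (f≡g zero)) (count-cong (f≡g ∘ suc))

count-mono : ∀ {n} {f g : Fin n → Bool} → (∀ i → T (f i) → T (g i)) → count f ≤ count g
count-mono {zero}  f⇒g = z≤n
count-mono {suc n} f⇒g = +-mono-≤ (indicator-mono (f⇒g zero)) (count-mono (f⇒g ∘ suc))

count-punchIn : ∀ {n} (f : Fin (suc n) → Bool) v → count f ≡ indicator (f v) + count (f ∘ punchIn v)
count-punchIn         f zero    = refl
count-punchIn {suc n} f (suc v) = begin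
  indicator (f zero) + count (f ∘ suc)
    ≡⟨ cong (indicator (f zero) +_) (count-punchIn (f ∘ suc) v) ⟩
  indicator (f zero) + (indicator (f (suc v)) + count (f ∘ suc ∘ punchIn v))
    ≡⟨ x∙yz≈y∙xz (indicator (f zero)) (indicator (f (suc v))) _ ⟩
  indicator (f (suc v)) + (indicator (f zero) + count (f ∘ suc ∘ punchIn v)) ∎
  where open ≡-Reasoning

count-pos : ∀ {n} (f : Fin n → Bool) a → T (f a) → 0 < count f
count-pos {suc n} f a fa rewrite count-punchIn f a | to T-≡ fa = s≤s z≤n

degree≡count : ∀ {n} (G : Graph n) u → degree G u ≡ count (G u)
degree≡count G u = length-filterᵇ-tabulate id (G u)

nbrCount≡count : ∀ {n} (G : Graph n) c u b → nbrCount G c u b ≡ count (λ x → G u x ∧ eqᵇ (lookup c x) b)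
nbrCount≡count G c u b = length-filterᵇ-tabulate id (λ x → G u x ∧ eqᵇ (lookup c x) b)

leaf-nonneighbours : ∀ {n} (G : Graph (suc n)) {v x} → IsLeaf G v → Adj G v x → count (G v ∘ punchIn x) ≡ 0
leaf-nonneighbours G {v} {x} leaf adj = sym (suc-injective (begin
  1                                         ≡⟨ sym leaf ⟩
  degree G v                                ≡⟨ degree≡count G v ⟩
  count (G v)                               ≡⟨ count-punchIn (G v) x ⟩
  indicator (G v x) + count (G v ∘ punchIn x)
    ≡⟨ cong (λ b → indicator b + count (G v ∘ punchIn x)) (to T-≡ adj) ⟩
  suc (count (G v ∘ punchIn x))             ∎))
  where open ≡-Reasoning

leaf-neighbour-unique : ∀ {n} (G : Graph (suc n)) {v x u} → IsLeaf G v → Adj G v x → Adj G v u → u ≡ x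
leaf-neighbour-unique G {v} {x} {u} leaf adj-x adj-u with u ≟ x
... | yes u≡x = u≡x
... | no  u≢x =
  contradiction (leaf-nonneighbours G leaf adj-x) (n>0⇒n≢0 (count-pos _ (punchOut x≢u) adj-u′))
  where
  x≢u : x ≢ u
  x≢u = u≢x ∘ sym
  adj-u′ : Adj G v (punchIn x (punchOut x≢u))
  adj-u′ = subst (Adj G v) (sym (punchIn-punchOut x≢u)) adj-u

count-leaf-neighbours : ∀ {n} (G : Graph (suc n)) {v x} → IsLeaf G v → Adj G v x →
  (h : Fin (suc n) → Bool) → count (λ u → G v u ∧ h u) ≡ indicator (h x)
count-leaf-neighbours G {v} {x} leaf adj h = begin
  count (λ u → G v u ∧ h u)                                   ≡⟨ count-punchIn (λ u → G v u ∧ h u) x ⟩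
  indicator (G v x ∧ h x) + count (λ i → G v (punchIn x i) ∧ h (punchIn x i))
    ≡⟨ cong₂ (λ b m → indicator (b ∧ h x) + m) (to T-≡ adj) others ⟩
  indicator (h x) + 0                                         ≡⟨ +-identityʳ _ ⟩
  indicator (h x)                                             ∎
  where
  open ≡-Reasoning
  others : count (λ i → G v (punchIn x i) ∧ h (punchIn x i)) ≡ 0
  others = n≤0⇒n≡0 (≤-trans (count-mono {g = G v ∘ punchIn x} (λ i → proj₁ ∘ to T-∧))
                              (≤-reflexive (leaf-nonneighbours G leaf adj)))

nbrCount-leaf : ∀ {n} (G : Graph (suc n)) {u x} → IsLeaf G u → Adj G u x →
  ∀ c b → nbrCount G c u b ≡ indicator (eqᵇ (lookup c x) b)
nbrCount-leaf G {u} leaf adj c b =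
  trans (nbrCount≡count G c u b) (count-leaf-neighbours G leaf adj (λ y → eqᵇ (lookup c y) b))

T-eqᵇ : ∀ {a b} → T (eqᵇ a b) ⇔ a ≡ b
T-eqᵇ {true}  {true}  = mk⇔ (λ _ → refl) (λ _ → _)
T-eqᵇ {false} {false} = mk⇔ (λ _ → refl) (λ _ → _)
T-eqᵇ {true}  {false} = mk⇔ (λ ()) (λ ())
T-eqᵇ {false} {true}  = mk⇔ (λ ()) (λ ())

eqᵇ-not : ∀ a → eqᵇ a (not a) ≡ false
eqᵇ-not true  = refl
eqᵇ-not false = refl

eqᵇ-refl : ∀ a → eqᵇ a a ≡ true
eqᵇ-refl true  = refl
eqᵇ-refl false = refl

T-≤ᵇ' : ∀ {m k} → T (m ≤ᵇ' k) ⇔ m ≤ k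
T-≤ᵇ' {zero}          = mk⇔ (λ _ → z≤n) (λ _ → _)
T-≤ᵇ' {suc m} {zero}  = mk⇔ (λ ()) (λ ())
T-≤ᵇ' {suc m} {suc k} = mk⇔ (s≤s ∘ to T-≤ᵇ') (from T-≤ᵇ' ∘ s≤s⁻¹)

preferred : Mode → Bool → Bool
preferred MAJ a = a
preferred MIN a = not a

preferred-involutive : ∀ M a → preferred M (preferred M a) ≡ a
preferred-involutive MAJ a = refl
preferred-involutive MIN a = not-involutive a

preferred-swap : ∀ M {a b} → a ≡ preferred M b → b ≡ preferred M a
preferred-swap M {b = b} refl = sym (preferred-involutive M b)

Balanced : (Bool → ℕ) → Bool → Set
Balanced N p = N (not p) ≤ N p

Balanced-cong : ∀ {N N′ : Bool → ℕ} {p} → (∀ b → N b ≡ N′ b) → Balanced N p ⇔ Balanced N′ p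
Balanced-cong {p = p} N≡N′ =
  mk⇔ (subst₂ _≤_ (N≡N′ (not p)) (N≡N′ p)) (subst₂ _≤_ (sym (N≡N′ (not p))) (sym (N≡N′ p)))

Balanced-indicator : ∀ y p → Balanced (indicator ∘ eqᵇ y) p ⇔ y ≡ p
Balanced-indicator true  true  = mk⇔ (λ _ → refl) (λ _ → z≤n)
Balanced-indicator false false = mk⇔ (λ _ → refl) (λ _ → z≤n)
Balanced-indicator true  false = mk⇔ (λ ()) (λ ())
Balanced-indicator false true  = mk⇔ (λ ()) (λ ())

-- Under both rules a vertex keeps its colour exactly when its neighbours of the preferred colour are
-- at least as many as the others (ties keep the colour).
Stable : ∀ {n} → Mode → Graph n → Coloring n → Fin n → Set
Stable M G c u = Balanced (nbrCount G c u) (preferred M (lookup c u))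

if-fixed⇔ : ∀ b a → (if b then a else not a) ≡ a ⇔ T b
if-fixed⇔ true  a     = mk⇔ (λ _ → _) (λ _ → refl)
if-fixed⇔ false true  = mk⇔ (λ ()) (λ ())
if-fixed⇔ false false = mk⇔ (λ ()) (λ ())

update-fixed⇔Stable : ∀ {n} M (G : Graph n) c u → update M G c u ≡ lookup c u ⇔ Stable M G c u
update-fixed⇔Stable MAJ G c u = T-≤ᵇ' ⇔-∘ if-fixed⇔ _ _
update-fixed⇔Stable MIN G c u =
  subst (λ a → update MIN G c u ≡ lookup c u ⇔ nbrCount G c u a ≤ nbrCount G c u (not (lookup c u)))
        (sym (not-involutive (lookup c u)))
        (T-≤ᵇ' ⇔-∘ if-fixed⇔ _ _)

apply-fixed⇔Stable : ∀ {n} M (G : Graph n) c → apply M G c ≡ c ⇔ (∀ u → Stable M G c u)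
apply-fixed⇔Stable M G c = mk⇔
  (λ fixed u → to (update-fixed⇔Stable M G c u)
                  (trans (sym (lookup∘tabulate (update M G c) u)) (cong (λ d → lookup d u) fixed)))
  (λ stable → trans (tabulate-cong (λ u → from (update-fixed⇔Stable M G c u) (stable u)))
                    (tabulate∘lookup c))

Stable-leaf⇔ : ∀ {n} M (G : Graph (suc n)) {u x} → IsLeaf G u → Adj G u x →
  ∀ c → Stable M G c u ⇔ lookup c u ≡ preferred M (lookup c x)
Stable-leaf⇔ M G {u} {x} leaf adj c =
  mk⇔ (preferred-swap M) (preferred-swap M)
    ⇔-∘ (Balanced-indicator (lookup c x) (preferred M (lookup c u))
    ⇔-∘ Balanced-cong (nbrCount-leaf G leaf adj c))

isLeafᵇ-sound : ∀ {n} (G : Graph n) u → T (isLeafᵇ G u) → IsLeaf G u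
isLeafᵇ-sound G u with degree G u
... | 1 = λ _ → refl
... | 0 = λ ()
... | suc (suc _) = λ ()

isInnerᵇ-complete : ∀ {n} (G : Graph n) u → degree G u ≢ 0 → ¬ IsLeaf G u → T (isInnerᵇ G u)
isInnerᵇ-complete G u with degree G u
... | 0 = λ d≢0 _ → contradiction refl d≢0
... | 1 = λ _ ¬leaf → contradiction refl ¬leaf
... | suc (suc _) = λ _ _ → _

LeavesColoured : ∀ {n} → Graph n → Coloring n → Fin n → Bool → Set
LeavesColoured G c x p = ∀ u → Adj G x u → IsLeaf G u → lookup c u ≡ p

Stable⇒LeavesColoured : ∀ {n} M (G : Graph (suc n)) c → (∀ u x → G u x ≡ G x u) →
  (∀ u → Stable M G c u) → ∀ x → LeavesColoured G c x (preferred M (lookup c x))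
Stable⇒LeavesColoured M G c symmetric stable x u adj leaf =
  to (Stable-leaf⇔ M G leaf (subst T (symmetric x u) adj) c) (stable u)

nLeaf≤nbrCount : ∀ {n} (G : Graph n) c x p → LeavesColoured G c x p → nLeaf G x ≤ nbrCount G c x p
nLeaf≤nbrCount G c x p coloured =
  subst₂ _≤_ (sym (length-filterᵇ-tabulate id (λ u → G x u ∧ isLeafᵇ G u)))
             (sym (nbrCount≡count G c x p))
    (count-mono leaf⇒coloured)
  where
  leaf⇒coloured : ∀ u → T (G x u ∧ isLeafᵇ G u) → T (G x u ∧ eqᵇ (lookup c u) p)
  leaf⇒coloured u h with to T-∧ h
  ... | adj , leaf = from T-∧ (adj , from T-eqᵇ (coloured u adj (isLeafᵇ-sound G u leaf)))

nbrCount≤nInner : ∀ {n} (G : Graph n) c x p → (∀ u x → G u x ≡ G x u) →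
  LeavesColoured G c x p → nbrCount G c x (not p) ≤ nInner G x
nbrCount≤nInner G c x p symmetric coloured =
  subst₂ _≤_ (sym (nbrCount≡count G c x (not p)))
             (sym (length-filterᵇ-tabulate id (λ u → G x u ∧ isInnerᵇ G u)))
    (count-mono miscoloured⇒inner)
  where
  miscoloured⇒inner : ∀ u → T (G x u ∧ eqᵇ (lookup c u) (not p)) → T (G x u ∧ isInnerᵇ G u)
  miscoloured⇒inner u h with to T-∧ h
  ... | adj , miscoloured = from T-∧ (adj , isInnerᵇ-complete G u has-neighbour not-leaf)
    where
    has-neighbour : degree G u ≢ 0
    has-neighbour = n>0⇒n≢0 (subst (0 <_) (sym (degree≡count G u))
                                   (count-pos (G u) x (subst T (symmetric x u) adj)))
    not-leaf : ¬ IsLeaf G u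
    not-leaf leaf = not-¬ (coloured u adj leaf) (to T-eqᵇ miscoloured)

lookup-removeAt : ∀ {n} {A : Set} (xs : Vec A (suc n)) v i → lookup (removeAt xs v) i ≡ lookup xs (punchIn v i)
lookup-removeAt xs v i =
  trans (cong (lookup (removeAt xs v)) (sym (punchOut-punchIn v))) (removeAt-punchOut xs (punchInᵢ≢i v i ∘ sym))

nbrCount-removeVertex : ∀ {n} (G : Graph (suc n)) c v i b →
  nbrCount G c (punchIn v i) b ≡
    indicator (G (punchIn v i) v ∧ eqᵇ (lookup c v) b) + nbrCount (removeVertex G v) (removeAt c v) i b
nbrCount-removeVertex G c v i b = begin
  nbrCount G c (punchIn v i) b                ≡⟨ nbrCount≡count G c (punchIn v i) b ⟩
  count F                                     ≡⟨ count-punchIn F v ⟩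
  indicator (F v) + count (F ∘ punchIn v)     ≡⟨ cong (indicator (F v) +_) (count-cong recolour) ⟩
  indicator (F v) + count F′                  ≡⟨ cong (indicator (F v) +_) (sym (nbrCount≡count G′ c′ i b)) ⟩
  indicator (F v) + nbrCount G′ c′ i b        ∎
  where
  open ≡-Reasoning
  G′ = removeVertex G v
  c′ = removeAt c v
  F : Fin (suc _) → Bool
  F u = G (punchIn v i) u ∧ eqᵇ (lookup c u) b
  F′ : Fin _ → Bool
  F′ k = G′ i k ∧ eqᵇ (lookup c′ k) b
  recolour : ∀ k → F (punchIn v k) ≡ F′ k
  recolour k = cong (λ y → G′ i k ∧ eqᵇ y b) (sym (lookup-removeAt c v k))

Stable-removeVertex : ∀ {n} M (G : Graph (suc n)) c v i → G (punchIn v i) v ≡ false →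
  Stable M G c (punchIn v i) ⇔ Stable M (removeVertex G v) (removeAt c v) i
Stable-removeVertex M G c v i nonadjacent =
  subst (λ a → Stable M G c (punchIn v i) ⇔ Balanced N′ (preferred M a)) (sym (lookup-removeAt c v i))
        (Balanced-cong (λ b → trans (nbrCount-removeVertex G c v i b)
                                    (cong (λ e → indicator (e ∧ eqᵇ (lookup c v) b) + N′ b) nonadjacent)))
  where
  N′ : Bool → ℕ
  N′ = nbrCount (removeVertex G v) (removeAt c v) i

all-punchIn : ∀ {n} {P : Fin (suc n) → Set} v → P v → (∀ i → P (punchIn v i)) → ∀ u → P u
all-punchIn {P = P} v Pv Pi u with v ≟ u
... | yes refl = Pv
... | no  v≢u  = subst P (punchIn-punchOut v≢u) (Pi (punchOut v≢u))

Fixed-≡ : ∀ {n M} {G : Graph n} {c d : Fixed M G} → proj₁ c ≡ proj₁ d → c ≡ d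
Fixed-≡ {c = c , p} {.c , q} refl = cong (c ,_) (Decidable⇒UIP.≡-irrelevant (≡-dec _≟ᵇ_) p q)

-- The neighbour of v is passed as its index w in T ∖ v, i.e. as the vertex punchIn v w of T.
module LeafRemoval {n} {G : Graph (suc n)} (simple : IsSimple G) (M : Mode)
  {v : Fin (suc n)} {w : Fin n} (leaf : IsLeaf G v) (adj : Adj G v (punchIn v w))
  (majority : nInner G (punchIn v w) < nLeaf G (punchIn v w)) where

  G′ : Graph n
  G′ = removeVertex G v

  symmetric : ∀ u x → G u x ≡ G x u
  symmetric = proj₁ simple

  hub-adjacent : G (punchIn v w) v ≡ true
  hub-adjacent = trans (symmetric (punchIn v w) v) (to T-≡ adj)

  nonadjacent : ∀ {i} → i ≢ w → G (punchIn v i) v ≡ false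
  nonadjacent {i} i≢w with G (punchIn v i) v in e
  ... | false = refl
  ... | true  = contradiction (punchIn-injective v i w (leaf-neighbour-unique G leaf adj adj-i)) i≢w
    where
    adj-i : Adj G v (punchIn v i)
    adj-i = subst T (symmetric (punchIn v i) v) (from T-≡ e)

  nbrCount-hub : ∀ c b →
    nbrCount G c (punchIn v w) b ≡ indicator (eqᵇ (lookup c v) b) + nbrCount G′ (removeAt c v) w b
  nbrCount-hub c b =
    trans (nbrCount-removeVertex G c v w b)
          (cong (λ e → indicator (e ∧ eqᵇ (lookup c v) b) + nbrCount G′ (removeAt c v) w b) hub-adjacent)

  votes-for : ∀ c {p} → lookup c v ≡ p →
    nbrCount G c (punchIn v w) p ≡ suc (nbrCount G′ (removeAt c v) w p)
  votes-for c refl = trans (nbrCount-hub c _)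
    (cong (λ e → indicator e + nbrCount G′ (removeAt c v) w (lookup c v)) (eqᵇ-refl (lookup c v)))

  votes-against : ∀ c {p} → lookup c v ≡ p →
    nbrCount G c (punchIn v w) (not p) ≡ nbrCount G′ (removeAt c v) w (not p)
  votes-against c refl = trans (nbrCount-hub c _)
    (cong (λ e → indicator e + nbrCount G′ (removeAt c v) w (not (lookup c v))) (eqᵇ-not (lookup c v)))

  restrict-Stable : ∀ c → (∀ u → Stable M G c u) → ∀ i → Stable M G′ (removeAt c v) i
  restrict-Stable c stable i with i ≟ w
  ... | no  i≢w = to (Stable-removeVertex M G c v i (nonadjacent i≢w)) (stable (punchIn v i))
  ... | yes refl =
    subst (λ a → Balanced (nbrCount G′ (removeAt c v) w) (preferred M a)) (sym (lookup-removeAt c v w))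
          (s≤s⁻¹ (subst₂ _<_ (votes-against c colour-v) (votes-for c colour-v) margin))
    where
    p = preferred M (lookup c (punchIn v w))
    colour-v : lookup c v ≡ p
    colour-v = to (Stable-leaf⇔ M G leaf adj c) (stable v)
    coloured : LeavesColoured G c (punchIn v w) p
    coloured = Stable⇒LeavesColoured M G c symmetric stable (punchIn v w)
    margin : nbrCount G c (punchIn v w) (not p) < nbrCount G c (punchIn v w) p
    margin = ≤-<-trans (nbrCount≤nInner G c (punchIn v w) p symmetric coloured)
                       (<-≤-trans majority (nLeaf≤nbrCount G c (punchIn v w) p coloured))

  insertLeaf : Coloring n → Coloring (suc n)
  insertLeaf c′ = insertAt c′ v (preferred M (lookup c′ w))

  insertLeaf-Stable : ∀ c′ → (∀ i → Stable M G′ c′ i) → ∀ u → Stable M G (insertLeaf c′) u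
  insertLeaf-Stable c′ stable′ = all-punchIn v at-leaf at-punchIn
    where
    c = insertLeaf c′
    p = preferred M (lookup c′ w)
    restored : removeAt c v ≡ c′
    restored = removeAt-insertAt c′ v p
    hub-colour : lookup c (punchIn v w) ≡ lookup c′ w
    hub-colour = insertAt-punchIn c′ v p w
    colour-v : lookup c v ≡ p
    colour-v = insertAt-lookup c′ v p
    at-leaf : Stable M G c v
    at-leaf = from (Stable-leaf⇔ M G leaf adj c) (trans colour-v (cong (preferred M) (sym hub-colour)))
    at-punchIn : ∀ i → Stable M G c (punchIn v i)
    at-punchIn i with i ≟ w
    ... | no  i≢w = from (Stable-removeVertex M G c v i (nonadjacent i≢w))
                         (subst (λ d → Stable M G′ d i) (sym restored) (stable′ i))
    ... | yes refl =
      subst (λ a → Balanced (nbrCount G c (punchIn v w)) (preferred M a)) (sym hub-colour)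
        (subst₂ _≤_ (sym (votes-against c colour-v)) (sym (votes-for c colour-v))
          (m≤n⇒m≤1+n (subst (λ d → Balanced (nbrCount G′ d w) p) (sym restored) (stable′ w))))

  restrict : Fixed M G → Fixed M G′
  restrict (c , fixed) = removeAt c v ,
    from (apply-fixed⇔Stable M G′ _) (restrict-Stable c (to (apply-fixed⇔Stable M G c) fixed))

  extend : Fixed M G′ → Fixed M G
  extend (c′ , fixed′) = insertLeaf c′ ,
    from (apply-fixed⇔Stable M G _) (insertLeaf-Stable c′ (to (apply-fixed⇔Stable M G′ c′) fixed′))

  restrict∘extend : ∀ c′ → restrict (extend c′) ≡ c′
  restrict∘extend (c′ , _) = Fixed-≡ {M = M} {G = G′} (removeAt-insertAt c′ v _)

  extend∘restrict : ∀ c → extend (restrict c) ≡ c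
  extend∘restrict (c , fixed) = Fixed-≡ {M = M} {G = G} (begin
    insertAt (removeAt c v) v (preferred M (lookup (removeAt c v) w))
      ≡⟨ cong (insertAt (removeAt c v) v ∘ preferred M) (lookup-removeAt c v w) ⟩
    insertAt (removeAt c v) v (preferred M (lookup c (punchIn v w)))
      ≡⟨ cong (insertAt (removeAt c v) v) (sym colour-v) ⟩
    insertAt (removeAt c v) v (lookup c v)
      ≡⟨ insertAt-removeAt c v ⟩
    c ∎)
    where
    open ≡-Reasoning
    colour-v : lookup c v ≡ preferred M (lookup c (punchIn v w))
    colour-v = to (Stable-leaf⇔ M G leaf adj c) (to (apply-fixed⇔Stable M G c) fixed v)

  Fixed-removeLeaf : Fixed M G ⤖ Fixed M G′
  Fixed-removeLeaf = ↔⇒⤖ (mk↔ₛ′ restrict extend restrict∘extend extend∘restrict)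

lemma7 : (n : ℕ) (G : Graph (suc n)) → IsTree G →
    (v w : Fin (suc n)) → IsLeaf G v → Adj G v w →
    (M : Mode) → nInner G w < nLeaf G w →
    Fixed M G ⤖ Fixed M (removeVertex G v)
lemma7 n G (simple , _) v w leaf adj M majority =
  LeafRemoval.Fixed-removeLeaf simple M leaf (subst (Adj G v) w≡punchIn adj)
    (subst (λ x → nInner G x < nLeaf G x) w≡punchIn majority)
  where
  v≢w : v ≢ w
  v≢w v≡w = subst T (proj₂ simple v) (subst (Adj G v) (sym v≡w) adj)
  w≡punchIn : w ≡ punchIn v (punchOut v≢w)
  w≡punchIn = sym (punchIn-punchOut v≢w)
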